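{- For each $i\ge 1$: $\psi_1(P_i)=F_{2i}$, $\psi_2(P_i)=Q_i$, and $\psi_3(Q_i)=P_{i+1}$, where $\psi_1,\psi_2,\psi_3$ are the morphisms on $\{\mathtt{a},\mathtt{b}\}^*$ given by $\psi_1(\mathtt{a})=\mathtt{a}$, $\psi_1(\mathtt{b})=\mathtt{ba}$; $\psi_2(\mathtt{a})=\mathtt{a}$, $\psi_2(\mathtt{b})=\mathtt{ab}$; $\psi_3(\mathtt{a})=\mathtt{ab}$, $\psi_3(\mathtt{b})=\mathtt{b}$.
   Context: Fibonacci words over $\{\mathtt{a},\mathtt{b}\}$: $F_1=\mathtt{b}$, $F_2=\mathtt{a}$, $F_i=F_{i-1}F_{i-2}$ for $i\ge 3$. $\pi$ is the morphism $\mathtt{a}\mapsto\mathtt{ab}$, $\mathtt{b}\mapsto\mathtt{abb}$; $\theta$ is the morphism $\mathtt{a}\mapsto\mathtt{aab}$, $\mathtt{b}\mapsto\mathtt{ab}$; $P_i=\pi^{i-1}(\mathtt{a})$ and $Q_i=\theta^{i-1}(\mathtt{a})$ for $i\ge 1$. -}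

module Defs where

open import Data.Nat using (ℕ; zero; suc; _∸_)
open import Data.List using (List; []; _∷_; _++_; concatMap)

data Σ₂ : Set where
  a b : Σ₂

Word : Set
Word = List Σ₂

Morphism : Set
Morphism = Σ₂ → Word

apply : Morphism → Word → Word
apply h w = concatMap h w

iter : ℕ → Morphism → Word → Word
iter zero    h w = w
iter (suc k) h w = apply h (iter k h w)

-- Fibonacci words, indexed so that  fib n = F_{n+1}:
-- F_1 = b, F_2 = a, F_i = F_{i-1} F_{i-2}
fib : ℕ → Word
fib zero          = b ∷ []
fib (suc zero)    = a ∷ []
fib (suc (suc n)) = fib (suc n) ++ fib n

-- F_i for i ≥ 1 (F 0 is a junk value = F_1, never used)
F : ℕ → Word
F zero    = fib zero
F (suc n) = fib n

π : Morphism
π a = a ∷ b ∷ []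
π b = a ∷ b ∷ b ∷ []

θ : Morphism
θ a = a ∷ a ∷ b ∷ []
θ b = a ∷ b ∷ []

P : ℕ → Word
P i = iter (i ∸ 1) π (a ∷ [])

Q : ℕ → Word
Q i = iter (i ∸ 1) θ (a ∷ [])

ψ₁ : Morphism
ψ₁ a = a ∷ []
ψ₁ b = b ∷ a ∷ []

ψ₂ : Morphism
ψ₂ a = a ∷ []
ψ₂ b = a ∷ b ∷ []

ψ₃ : Morphism
ψ₃ a = a ∷ b ∷ []
ψ₃ b = b ∷ []

-- Each ψ intertwines two of the morphisms: ψ₁ ∘ π = φ² ∘ ψ₁ for the Fibonacci morphism
-- φ : a ↦ ab, b ↦ a, ψ₂ ∘ π = θ ∘ ψ₂ and ψ₃ ∘ θ = π ∘ ψ₃, which are checked on the two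
-- letters. An intertwining ψ ∘ g = h ∘ ψ carries g-iterates of a to h-iterates of ψ(a),
-- and ψ₁(a) = ψ₂(a) = a while ψ₃(a) = ab = π(a); since φⁿ(a) = F_{n+2}, the three
-- identities follow.
module Submission where

open import Defs
open import Data.Nat using (ℕ; _≤_; _*_; _+_; zero; suc; s≤s)
open import Data.Nat.Properties using (+-suc; +-identityʳ; +-comm)
open import Data.Product using (_×_; _,_)
open import Data.List using ([]; _∷_; _++_)
open import Data.List.Properties using (concatMap-++; concatMap-cong)
open import Data.List.Effectful using (module MonadProperties)
open import Relation.Binary.PropositionalEquality

infixr 9 _⊙_

_⊙_ : Morphism → Morphism → Morphism
(g ⊙ h) c = apply g (h c)

apply-⊙ : ∀ g h w → apply (g ⊙ h) w ≡ apply g (apply h w)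
apply-⊙ g h w = MonadProperties.associative w h g

apply-cong : ∀ {g h} → (∀ c → g c ≡ h c) → ∀ w → apply g w ≡ apply h w
apply-cong = concatMap-cong

apply-iter-intertwine : ∀ ψ g h → (∀ c → (ψ ⊙ g) c ≡ (h ⊙ ψ) c) →
  ∀ n w → apply ψ (iter n g w) ≡ iter n h (apply ψ w)
apply-iter-intertwine ψ g h comm zero    w = refl
apply-iter-intertwine ψ g h comm (suc n) w = begin
  apply ψ (apply g (iter n g w))   ≡⟨ apply-⊙ ψ g (iter n g w) ⟨
  apply (ψ ⊙ g) (iter n g w)       ≡⟨ apply-cong comm (iter n g w) ⟩
  apply (h ⊙ ψ) (iter n g w)       ≡⟨ apply-⊙ h ψ (iter n g w) ⟩
  apply h (apply ψ (iter n g w))   ≡⟨ cong (apply h) (apply-iter-intertwine ψ g h comm n w) ⟩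
  apply h (iter n h (apply ψ w))   ∎
  where open ≡-Reasoning

iter-apply : ∀ n h w → iter n h (apply h w) ≡ apply h (iter n h w)
iter-apply zero    h w = refl
iter-apply (suc n) h w = cong (apply h) (iter-apply n h w)

iter-⊙-self : ∀ n h w → iter n (h ⊙ h) w ≡ iter (n + n) h w
iter-⊙-self zero    h w = refl
iter-⊙-self (suc n) h w rewrite +-suc n n =
  trans (apply-⊙ h h (iter n (h ⊙ h) w)) (cong (λ u → apply h (apply h u)) (iter-⊙-self n h w))

φ : Morphism
φ a = a ∷ b ∷ []
φ b = a ∷ []

apply-φ-fib : ∀ n → apply φ (fib (suc n)) ≡ fib (suc (suc n))
apply-φ-fib zero          = refl
apply-φ-fib (suc zero)    = refl
apply-φ-fib (suc (suc n)) =
  trans (concatMap-++ φ (fib (suc (suc n))) (fib (suc n)))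
        (cong₂ _++_ (apply-φ-fib (suc n)) (apply-φ-fib n))

iter-φ-a : ∀ n → iter n φ (a ∷ []) ≡ fib (suc n)
iter-φ-a zero    = refl
iter-φ-a (suc n) = trans (cong (apply φ) (iter-φ-a n)) (apply-φ-fib n)

ψ₁⊙π≗φ²⊙ψ₁ : ∀ c → (ψ₁ ⊙ π) c ≡ ((φ ⊙ φ) ⊙ ψ₁) c
ψ₁⊙π≗φ²⊙ψ₁ a = refl
ψ₁⊙π≗φ²⊙ψ₁ b = refl

ψ₂⊙π≗θ⊙ψ₂ : ∀ c → (ψ₂ ⊙ π) c ≡ (θ ⊙ ψ₂) c
ψ₂⊙π≗θ⊙ψ₂ a = refl
ψ₂⊙π≗θ⊙ψ₂ b = refl

ψ₃⊙θ≗π⊙ψ₃ : ∀ c → (ψ₃ ⊙ θ) c ≡ (π ⊙ ψ₃) c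
ψ₃⊙θ≗π⊙ψ₃ a = refl
ψ₃⊙θ≗π⊙ψ₃ b = refl

lemma6 : (i : ℕ) → 1 ≤ i →
    (apply ψ₁ (P i) ≡ F (2 * i)) × (apply ψ₂ (P i) ≡ Q i) × (apply ψ₃ (Q i) ≡ P (i + 1))
lemma6 (suc n) (s≤s _) = ψ₁-P , ψ₂-P , ψ₃-Q
  where
  ψ₁-P : apply ψ₁ (iter n π (a ∷ [])) ≡ F (2 * suc n)
  ψ₁-P rewrite +-identityʳ n | +-suc n n = begin
    apply ψ₁ (iter n π (a ∷ []))   ≡⟨ apply-iter-intertwine ψ₁ π (φ ⊙ φ) ψ₁⊙π≗φ²⊙ψ₁ n (a ∷ []) ⟩
    iter n (φ ⊙ φ) (a ∷ [])        ≡⟨ iter-⊙-self n φ (a ∷ []) ⟩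
    iter (n + n) φ (a ∷ [])        ≡⟨ iter-φ-a (n + n) ⟩
    fib (suc (n + n))              ∎
    where open ≡-Reasoning

  ψ₂-P : apply ψ₂ (iter n π (a ∷ [])) ≡ iter n θ (a ∷ [])
  ψ₂-P = apply-iter-intertwine ψ₂ π θ ψ₂⊙π≗θ⊙ψ₂ n (a ∷ [])

  ψ₃-Q : apply ψ₃ (iter n θ (a ∷ [])) ≡ iter (n + 1) π (a ∷ [])
  ψ₃-Q rewrite +-comm n 1 =
    trans (apply-iter-intertwine ψ₃ θ π ψ₃⊙θ≗π⊙ψ₃ n (a ∷ [])) (iter-apply n π (a ∷ []))
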